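{- Let $(a,b,c)$ be a $3$-multiplicatively dependent triple of positive integers and let $a=p_1^{x_1}\cdots p_n^{x_n}$ be the prime factorisation of $a$ (distinct primes $p_i$, positive exponents $x_i$). Then there exist nonnegative integers $y_1,\ldots,y_n,z_1,\ldots,z_n$ and positive integers $q,\beta,\gamma$ such that $$b=p_1^{y_1}\cdots p_n^{y_n}\,q^{\beta},\qquad c=p_1^{z_1}\cdots p_n^{z_n}\,q^{\gamma},$$ and $\gamma\cdot(y_1,\ldots,y_n)\neq\beta\cdot(z_1,\ldots,z_n)$. Moreover, if $q>1$, then these can be chosen so that additionally $\gamma y_i\neq\beta z_i$ for all $i=1,\ldots,n$.
   Context: An $n$-tuple $(z_1,\ldots,z_n)\in\mathbb{C}^n$ is called multiplicatively dependent if there exists a non-zero integer vector $(k_1,\ldots,k_n)\in\mathbb{Z}^n$ such that $z_1^{k_1}\cdots z_n^{k_n}=1$; otherwise it is multiplicatively independent. An $n$-tuple $(a_1,\ldots,a_n)$ is called $k$-multiplicatively dependent if there is a multiplicatively dependent $k$-subtuple and every $(k-1)$-subtuple is multiplicatively independent. In particular, a triple is $3$-multiplicatively dependent if it is multiplicatively dependent and each of its pairs is multiplicatively independent. -}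

module Defs where

open import Data.Nat as ℕ using (ℕ; zero; suc; NonZero)
open import Data.Integer as ℤ using (ℤ; +_; -[1+_])
open import Data.Rational as ℚ using (ℚ; 0ℚ; 1ℚ)
open import Data.Fin using (Fin; zero; suc)
open import Data.Product using (Σ; ∃; _×_)
open import Relation.Binary.PropositionalEquality using (_≡_; _≢_)
open import Relation.Nullary using (¬_)

∏ : ∀ {n} → (Fin n → ℕ) → ℕ
∏ {zero}  f = 1
∏ {suc n} f = f zero ℕ.* ∏ (λ i → f (suc i))

∏ℚ : ∀ {n} → (Fin n → ℚ) → ℚ
∏ℚ {zero}  f = 1ℚ
∏ℚ {suc n} f = f zero ℚ.* ∏ℚ (λ i → f (suc i))

-- 1/m as a rational (only ever used with m ≥ 1; set to 0 for m = 0).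
inv : ℕ → ℚ
inv zero    = 0ℚ
inv (suc m) = (+ 1) ℚ./ suc m

-- Integer power a^k of a natural number a, as a rational number.
-- (Only meaningful for a ≥ 1, which is always assumed where it is used.)
zpow : ℕ → ℤ → ℚ
zpow a (+ k)      = (+ (a ℕ.^ k)) ℚ./ 1
zpow a -[1+ k ]   = inv (a ℕ.^ suc k)

MultDep : ∀ {n} → (Fin n → ℕ) → Set
MultDep {n} z = Σ (Fin n → ℤ) λ k → (∃ λ i → k i ≢ + 0) × ∏ℚ (λ i → zpow (z i) (k i)) ≡ 1ℚ

pair : ℕ → ℕ → Fin 2 → ℕ
pair a b zero    = a
pair a b (suc _) = b

triple : ℕ → ℕ → ℕ → Fin 3 → ℕ
triple a b c zero          = a
triple a b c (suc zero)    = b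
triple a b c (suc (suc _)) = c

ThreeMultDep : ℕ → ℕ → ℕ → Set
ThreeMultDep a b c =
  MultDep (triple a b c) ×
  ¬ MultDep (pair a b) × ¬ MultDep (pair a c) × ¬ MultDep (pair b c)

{-# OPTIONS --safe #-}

-- Write a dependence a^k₀ b^k₁ c^k₂ = 1 as an identity of natural numbers
-- a^k₀⁺ b^k₁⁺ c^k₂⁺ = a^k₀⁻ b^k₁⁻ c^k₂⁻; pairwise independence forces every kᵢ ≠ 0.
-- Split b = p^y B and c = p^z C with B and C prime to every pᵢ. Unique
-- factorisation separates the identity into one linear relation
-- xᵢk₀ + yᵢk₁ + zᵢk₂ = 0 per prime and the identity B^k₁ C^k₂ = 1, which makes
-- B and C powers q^β, q^γ of a common base, with βk₁ + γk₂ = 0 when q > 1.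
-- If γy = βz then b^γ = c^β, contradicting the independence of (b, c); if q > 1
-- and γyᵢ = βzᵢ for a single i, then β times the i-th relation reads βxᵢk₀ = 0.

module Submission where

open import Defs
open import Algebra.Bundles using (CommutativeMonoid)
open import Data.Nat using (ℕ; zero; suc; _+_; _*_; _^_; _<_; _≤_; NonZero; >-nonZero; >-nonZero⁻¹)
open import Data.Nat.Properties
open import Data.Nat.Divisibility
open import Data.Nat.Primality
open import Data.Nat.Primality.Factorisation using (factorise)
open import Data.Nat.Induction using (<-rec)
open import Data.Nat.ListAction using (product)
open import Data.Nat.Tactic.RingSolver using (solve-∀)
import Data.Nat.Coprimality as C
open import Data.Integer as ℤ using (ℤ; +_; -[1+_])
import Data.Integer.Properties as ℤ
open import Data.Rational as ℚ using (ℚ; 1ℚ; mkℚ; _/_)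
import Data.Rational.Properties as ℚ
open import Data.List using (_∷_)
open import Data.List.Relation.Unary.All using (All; []; _∷_)
open import Data.Fin using (Fin; zero; suc; punchIn; punchOut)
import Data.Fin.Properties as FinP
open import Data.Vec.Functional using () renaming (_∷_ to _∷ᵛ_)
open import Data.Product using (Σ; ∃; ∃-syntax; _×_; _,_; proj₁; proj₂)
open import Data.Sum using (inj₁; inj₂; [_,_])
open import Function.Base using (_∘_; it)
open import Function.Definitions using (Injective)
open import Relation.Binary.Definitions using (tri<; tri≈; tri>)
open import Relation.Binary.PropositionalEquality
  using (_≡_; _≢_; refl; sym; trans; cong; cong₂; subst; subst₂; module ≡-Reasoning)
open import Relation.Nullary using (¬_; yes; no; contradiction)
open import Algebra.Properties.CommutativeSemigroup *-commutativeSemigroup using (x∙yz≈y∙xz)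
open import Algebra.Properties.CommutativeSemigroup
  (CommutativeMonoid.commutativeSemigroup ℚ.*-1-commutativeMonoid)
  using () renaming (interchange to ℚ-interchange; x∙yz≈y∙xz to ℚ-x∙yz≈y∙xz)

private
  variable
    m n p r u w : ℕ

^-distribʳ-* : ∀ m n k → (m * n) ^ k ≡ m ^ k * n ^ k
^-distribʳ-* m n zero    = refl
^-distribʳ-* m n (suc k) = begin
  m * n * (m * n) ^ k      ≡⟨ cong (m * n *_) (^-distribʳ-* m n k) ⟩
  m * n * (m ^ k * n ^ k)  ≡⟨ [m*n]*[o*p]≡[m*o]*[n*p] m n _ _ ⟩
  m ^ suc k * n ^ suc k    ∎
  where open ≡-Reasoning

^-cancelˡ-≡ : ∀ {m i j} → 1 < m → m ^ i ≡ m ^ j → i ≡ j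
^-cancelˡ-≡ {m} {i} {j} 1<m eq with <-cmp i j
... | tri< i<j _ _ = contradiction eq (<⇒≢ (^-monoʳ-< m 1<m i<j))
... | tri≈ _ i≡j _ = i≡j
... | tri> _ _ j<i = contradiction (sym eq) (<⇒≢ (^-monoʳ-< m 1<m j<i))

prime∤1 : Prime p → p ∤ 1
prime∤1 pr p∣1 = ¬prime[1] (subst Prime (∣1⇒≡1 p∣1) pr)

prime∤-* : Prime p → p ∤ m → p ∤ n → p ∤ m * n
prime∤-* {m = m} {n} pr p∤m p∤n p∣mn with euclidsLemma m n pr p∣mn
... | inj₁ p∣m = p∤m p∣m
... | inj₂ p∣n = p∤n p∣n

prime∤-^ : ∀ k → Prime p → p ∤ m → p ∤ m ^ k
prime∤-^ zero    pr p∤m = prime∤1 pr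
prime∤-^ (suc k) pr p∤m = prime∤-* pr p∤m (prime∤-^ k pr p∤m)

prime∣^⇒∣ : ∀ k → Prime p → p ∣ m ^ k → p ∣ m
prime∣^⇒∣ {p} {m} k pr p∣m^k with p ∣? m
... | yes p∣m = p∣m
... | no  p∤m = contradiction p∣m^k (prime∤-^ k pr p∤m)

prime∣prime⇒≡ : Prime p → Prime r → p ∣ r → p ≡ r
prime∣prime⇒≡ pp pr p∣r with prime⇒irreducible pr p∣r
... | inj₁ p≡1 = contradiction (subst Prime p≡1 pp) ¬prime[1]
... | inj₂ p≡r = p≡r

-- Products of prime powers and unique factorisation

infixr 8 _^ᵛ_

_^ᵛ_ : ∀ {n} → (Fin n → ℕ) → (Fin n → ℕ) → ℕ
z ^ᵛ e = ∏ (λ i → z i ^ e i)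

^ᵛ-cong : ∀ {n} {z w e f : Fin n → ℕ} →
          (∀ i → z i ≡ w i) → (∀ i → e i ≡ f i) → z ^ᵛ e ≡ w ^ᵛ f
^ᵛ-cong {zero}  z≡w e≡f = refl
^ᵛ-cong {suc n} z≡w e≡f =
  cong₂ _*_ (cong₂ _^_ (z≡w zero) (e≡f zero)) (^ᵛ-cong (z≡w ∘ suc) (e≡f ∘ suc))

^ᵛ-distribˡ-+-* : ∀ {n} (z e f : Fin n → ℕ) → z ^ᵛ (λ i → e i + f i) ≡ z ^ᵛ e * z ^ᵛ f
^ᵛ-distribˡ-+-* {zero}  z e f = refl
^ᵛ-distribˡ-+-* {suc n} z e f = begin
  z zero ^ (e zero + f zero) * zs ^ᵛ (λ i → e (suc i) + f (suc i))
    ≡⟨ cong₂ _*_ (^-distribˡ-+-* (z zero) (e zero) (f zero)) (^ᵛ-distribˡ-+-* zs (e ∘ suc) (f ∘ suc)) ⟩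
  z zero ^ e zero * z zero ^ f zero * (zs ^ᵛ (e ∘ suc) * zs ^ᵛ (f ∘ suc))
    ≡⟨ [m*n]*[o*p]≡[m*o]*[n*p] (z zero ^ e zero) _ _ _ ⟩
  z ^ᵛ e * z ^ᵛ f ∎
  where
  open ≡-Reasoning
  zs : Fin n → ℕ
  zs = z ∘ suc

^ᵛ-^ : ∀ {n} (z e : Fin n → ℕ) k → (z ^ᵛ e) ^ k ≡ z ^ᵛ (λ i → e i * k)
^ᵛ-^ {zero}  z e k = ^-zeroˡ k
^ᵛ-^ {suc n} z e k = begin
  (z zero ^ e zero * zs ^ᵛ es) ^ k          ≡⟨ ^-distribʳ-* (z zero ^ e zero) _ k ⟩
  (z zero ^ e zero) ^ k * (zs ^ᵛ es) ^ k    ≡⟨ cong₂ _*_ (^-*-assoc (z zero) (e zero) k) (^ᵛ-^ zs es k) ⟩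
  z ^ᵛ (λ i → e i * k)                       ∎
  where
  open ≡-Reasoning
  zs es : Fin n → ℕ
  zs = z ∘ suc
  es = e ∘ suc

^ᵛ-nonZero : ∀ {n} (z e : Fin n → ℕ) → (∀ i → NonZero (z i)) → NonZero (z ^ᵛ e)
^ᵛ-nonZero {zero}  z e z≢0 = _
^ᵛ-nonZero {suc n} z e z≢0 =
  m*n≢0 _ _ {{m^n≢0 (z zero) (e zero) {{z≢0 zero}}}} {{^ᵛ-nonZero (z ∘ suc) (e ∘ suc) (z≢0 ∘ suc)}}

^ᵛ-punchIn : ∀ {n} (z e : Fin (suc n) → ℕ) i →
             z ^ᵛ e ≡ z i ^ e i * (λ j → z (punchIn i j)) ^ᵛ (λ j → e (punchIn i j))
^ᵛ-punchIn         z e zero    = refl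
^ᵛ-punchIn {suc n} z e (suc i) = begin
  z zero ^ e zero * zs ^ᵛ es
    ≡⟨ cong (z zero ^ e zero *_) (^ᵛ-punchIn zs es i) ⟩
  z zero ^ e zero * (z (suc i) ^ e (suc i) * rest)
    ≡⟨ x∙yz≈y∙xz (z zero ^ e zero) (z (suc i) ^ e (suc i)) rest ⟩
  z (suc i) ^ e (suc i) * (z zero ^ e zero * rest) ∎
  where
  open ≡-Reasoning
  zs es : Fin (suc n) → ℕ
  zs = z ∘ suc
  es = e ∘ suc
  rest : ℕ
  rest = (λ j → zs (punchIn i j)) ^ᵛ (λ j → es (punchIn i j))

prime∤^ᵛ : ∀ {n} (w e : Fin n → ℕ) → Prime p → (∀ i → p ∤ w i) → p ∤ w ^ᵛ e
prime∤^ᵛ {n = zero}  w e pp p∤w = prime∤1 pp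
prime∤^ᵛ {n = suc n} w e pp p∤w =
  prime∤-* pp (prime∤-^ (e zero) pp (p∤w zero)) (prime∤^ᵛ (w ∘ suc) (e ∘ suc) pp (p∤w ∘ suc))

splitPrime-product : Prime p → ∀ {qs} → All Prime qs → ∃[ e ] ∃[ r ] product qs ≡ p ^ e * r × p ∤ r
splitPrime-product pp [] = 0 , 1 , refl , prime∤1 pp
splitPrime-product {p} pp {q ∷ qs} (q-prime ∷ qs-prime) with splitPrime-product pp qs-prime
... | e , r , qs≡ , p∤r with p ≟ q
...   | yes refl = suc e , r , trans (cong (p *_) qs≡) (sym (*-assoc p (p ^ e) r)) , p∤r
...   | no  p≢q  = e , q * r , trans (cong (q *_) qs≡) (x∙yz≈y∙xz q (p ^ e) r) ,
                   prime∤-* pp (p≢q ∘ prime∣prime⇒≡ pp q-prime) p∤r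

splitPrime : Prime p → ∀ m → {{NonZero m}} → ∃[ e ] ∃[ r ] m ≡ p ^ e * r × p ∤ r
splitPrime pp m with factorise m
... | record { factors = qs ; isFactorisation = m≡ ; factorsPrime = qs-prime }
  with splitPrime-product pp qs-prime
...   | e , r , qs≡ , p∤r = e , r , trans m≡ qs≡ , p∤r

decompose : ∀ {n} (p : Fin n → ℕ) → (∀ i → Prime (p i)) → ∀ m → {{NonZero m}} →
            ∃[ y ] ∃[ B ] m ≡ p ^ᵛ y * B × (∀ i → p i ∤ B)
decompose {zero}  p p-prime m = (λ ()) , m , sym (*-identityˡ m) , λ ()
decompose {suc n} p p-prime m with splitPrime (p-prime zero) m
... | e , r , m≡ , p₀∤r
  with decompose (p ∘ suc) (p-prime ∘ suc) r {{m*n≢0⇒n≢0 (p zero ^ e) {{subst NonZero m≡ it}}}}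
...   | y , B , r≡ , ps∤B =
  e ∷ᵛ y , B , trans m≡ (trans (cong (p zero ^ e *_) r≡) (sym (*-assoc (p zero ^ e) _ B))) ,
  λ { zero    p₀∣B → p₀∤r (subst (p zero ∣_) (sym r≡) (∣n⇒∣m*n ((p ∘ suc) ^ᵛ y) p₀∣B))
    ; (suc i) → ps∤B i }

primePower*-injective : ∀ e f → Prime p → p ∤ u → p ∤ w → p ^ e * u ≡ p ^ f * w → e ≡ f × u ≡ w
primePower*-injective {u = u} {w} zero zero pp p∤u p∤w eq =
  refl , trans (sym (*-identityˡ u)) (trans eq (*-identityˡ w))
primePower*-injective {p} {u} {w} zero (suc f) pp p∤u p∤w eq =
  contradiction (subst (p ∣_) (sym (trans (sym (*-identityˡ u)) eq)) (∣m⇒∣m*n w (m∣m*n (p ^ f)))) p∤u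
primePower*-injective {p} {u} {w} (suc e) zero pp p∤u p∤w eq =
  contradiction (subst (p ∣_) (trans eq (*-identityˡ w)) (∣m⇒∣m*n u (m∣m*n (p ^ e)))) p∤w
primePower*-injective {p} {u} {w} (suc e) (suc f) pp p∤u p∤w eq
  with primePower*-injective e f pp p∤u p∤w
         (*-cancelˡ-≡ _ _ p {{prime⇒nonZero pp}} (trans (sym (*-assoc p _ u)) (trans eq (*-assoc p _ w))))
... | refl , u≡w = refl , u≡w

^ᵛ*-injective : ∀ {n} (p : Fin n → ℕ) → (∀ i → Prime (p i)) → Injective _≡_ _≡_ p →
                ∀ e f → (∀ i → p i ∤ u) → (∀ i → p i ∤ w) →
                p ^ᵛ e * u ≡ p ^ᵛ f * w → (∀ i → e i ≡ f i) × u ≡ w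
^ᵛ*-injective {u = u} {w} {zero} p p-prime p-inj e f p∤u p∤w eq =
  (λ ()) , trans (sym (*-identityˡ u)) (trans eq (*-identityˡ w))
^ᵛ*-injective {u = u} {w} {suc n} p p-prime p-inj e f p∤u p∤w eq = e≡f , proj₂ tail
  where
  p₀∤ : ∀ {v} (g : Fin (suc n) → ℕ) → (∀ i → p i ∤ v) → p zero ∤ (p ∘ suc) ^ᵛ (g ∘ suc) * v
  p₀∤ g p∤v = prime∤-* (p-prime zero)
    (prime∤^ᵛ (p ∘ suc) (g ∘ suc) (p-prime zero)
      (λ i → FinP.0≢1+n ∘ p-inj ∘ prime∣prime⇒≡ (p-prime zero) (p-prime (suc i))))
    (p∤v zero)
  head : e zero ≡ f zero × (p ∘ suc) ^ᵛ (e ∘ suc) * u ≡ (p ∘ suc) ^ᵛ (f ∘ suc) * w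
  head = primePower*-injective (e zero) (f zero) (p-prime zero) (p₀∤ e p∤u) (p₀∤ f p∤w)
           (trans (sym (*-assoc (p zero ^ e zero) ((p ∘ suc) ^ᵛ (e ∘ suc)) u))
             (trans eq (*-assoc (p zero ^ f zero) ((p ∘ suc) ^ᵛ (f ∘ suc)) w)))
  tail : (∀ i → e (suc i) ≡ f (suc i)) × u ≡ w
  tail = ^ᵛ*-injective (p ∘ suc) (p-prime ∘ suc) (FinP.suc-injective ∘ p-inj)
           (e ∘ suc) (f ∘ suc) (p∤u ∘ suc) (p∤w ∘ suc) (proj₂ head)
  e≡f : ∀ i → e i ≡ f i
  e≡f zero    = proj₁ head
  e≡f (suc i) = proj₁ tail i

-- Equal powers have a common base

product^∣^⇒∣ : ∀ k {qs} → All Prime qs → ∀ {w} → product qs ^ suc k ∣ w ^ suc k → product qs ∣ w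
product^∣^⇒∣ k [] {w} _ = 1∣ w
product^∣^⇒∣ k {q ∷ qs} (q-prime ∷ qs-prime) {w} qP^k∣w^k =
  subst (q * product qs ∣_) (sym w≡q*w′) (*-monoʳ-∣ q (product^∣^⇒∣ k qs-prime P^k∣w′^k))
  where
  q^k*P^k∣w^k : q ^ suc k * product qs ^ suc k ∣ w ^ suc k
  q^k*P^k∣w^k = subst (_∣ w ^ suc k) (^-distribʳ-* q (product qs) (suc k)) qP^k∣w^k
  q∣w : q ∣ w
  q∣w = prime∣^⇒∣ (suc k) q-prime (∣-trans (m∣m*n (q ^ k)) (m*n∣⇒m∣ (q ^ suc k) _ q^k*P^k∣w^k))
  w′ : ℕ
  w′ = quotient q∣w
  w≡q*w′ : w ≡ q * w′
  w≡q*w′ = m∣n⇒n≡m*quotient q∣w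
  P^k∣w′^k : product qs ^ suc k ∣ w′ ^ suc k
  P^k∣w′^k = *-cancelˡ-∣ (q ^ suc k) {{m^n≢0 q (suc k) {{prime⇒nonZero q-prime}}}}
    (subst (q ^ suc k * product qs ^ suc k ∣_)
           (trans (cong (_^ suc k) w≡q*w′) (^-distribʳ-* q w′ (suc k))) q^k*P^k∣w^k)

^∣^⇒∣ : ∀ k {u w} → {{NonZero u}} → u ^ suc k ∣ w ^ suc k → u ∣ w
^∣^⇒∣ k {u} u^k∣w^k with factorise u
... | record { factors = qs ; isFactorisation = refl ; factorsPrime = qs-prime } =
  product^∣^⇒∣ k qs-prime u^k∣w^k

^≡^*^⇒quotient : ∀ {x y} m d → {{NonZero y}} → x ^ suc m ≡ y ^ suc m * y ^ d →
                 ∃[ t ] x ≡ t * y × t ^ suc m ≡ y ^ d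
^≡^*^⇒quotient {x} {y} m d eq =
  t , x≡t*y , *-cancelʳ-≡ (t ^ suc m) (y ^ d) (y ^ suc m) {{m^n≢0 y (suc m)}} (begin
  t ^ suc m * y ^ suc m  ≡⟨ ^-distribʳ-* t y (suc m) ⟨
  (t * y) ^ suc m        ≡⟨ cong (_^ suc m) x≡t*y ⟨
  x ^ suc m              ≡⟨ eq ⟩
  y ^ suc m * y ^ d      ≡⟨ *-comm (y ^ suc m) (y ^ d) ⟩
  y ^ d * y ^ suc m      ∎)
  where
  open ≡-Reasoning
  y∣x : y ∣ x
  y∣x = ^∣^⇒∣ m (divides (y ^ d) (trans eq (*-comm (y ^ suc m) (y ^ d))))
  t : ℕ
  t = quotient y∣x
  x≡t*y : x ≡ t * y
  x≡t*y = m∣n⇒n≡quotient*m y∣x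

record CommonBase (x y : ℕ) : Set where
  field
    q β γ : ℕ
    1≤q   : 1 ≤ q
    1≤β   : 1 ≤ β
    1≤γ   : 1 ≤ γ
    x≡q^β : x ≡ q ^ β
    y≡q^γ : y ≡ q ^ γ

commonBase-refl : ∀ x → {{NonZero x}} → CommonBase x x
commonBase-refl x = record
  { q = x ; β = 1 ; γ = 1 ; 1≤q = >-nonZero⁻¹ x ; 1≤β = ≤-refl ; 1≤γ = ≤-refl
  ; x≡q^β = sym (*-identityʳ x) ; y≡q^γ = sym (*-identityʳ x) }

commonBase-sym : ∀ {x y} → CommonBase x y → CommonBase y x
commonBase-sym cb = record
  { q = q ; β = γ ; γ = β ; 1≤q = 1≤q ; 1≤β = 1≤γ ; 1≤γ = 1≤β
  ; x≡q^β = y≡q^γ ; y≡q^γ = x≡q^β }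
  where open CommonBase cb

commonBase-*ˡ : ∀ {x t y} → x ≡ t * y → CommonBase t y → CommonBase x y
commonBase-*ˡ {x} {t} {y} x≡t*y cb = record
  { q = q ; β = β + γ ; γ = γ ; 1≤q = 1≤q ; 1≤β = ≤-trans 1≤β (m≤m+n β γ) ; 1≤γ = 1≤γ
  ; x≡q^β = trans x≡t*y (trans (cong₂ _*_ x≡q^β y≡q^γ) (sym (^-distribˡ-+-* q β γ)))
  ; y≡q^γ = y≡q^γ }
  where open CommonBase cb

-- Euclid's algorithm on the exponents: if m ≤ n then x^m = y^n forces y ∣ x,
-- and t = x / y satisfies t^m = y^(n - m).
^≡^⇒commonBase : ∀ {x y} m n → {{NonZero x}} → {{NonZero y}} → x ^ suc m ≡ y ^ suc n → CommonBase x y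
^≡^⇒commonBase m n = <-rec P step (m + n) m n refl
  where
  P : ℕ → Set
  P s = ∀ {x y} m n → m + n ≡ s → {{NonZero x}} → {{NonZero y}} →
        x ^ suc m ≡ y ^ suc n → CommonBase x y

  step : ∀ s → (∀ {r} → r < s → P r) → P s
  step s ih m n m+n≡s eq =
    [ (λ m≤n → ordered m n m≤n (subst (n ≤_) m+n≡s (m≤n+m n m)) eq)
    , (λ n≤m → commonBase-sym (ordered n m n≤m (subst (m ≤_) m+n≡s (m≤m+n m n)) (sym eq)))
    ] (≤-total m n)
    where
    ordered : ∀ {x y} m n → {{NonZero x}} → {{NonZero y}} → m ≤ n → n ≤ s →
              x ^ suc m ≡ y ^ suc n → CommonBase x y
    ordered m n m≤n n≤s eq with m≤n⇒∃[o]m+o≡n m≤n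
    ordered {x} {y} m _ m≤n n≤s eq | zero , refl
      with ^≡^*^⇒quotient m 0 (trans eq (^-distribˡ-+-* y (suc m) 0))
    ... | t , x≡t*y , t^m≡1 = subst (λ v → CommonBase v y) (sym x≡y) (commonBase-refl y)
      where
      t≡1 : t ≡ 1
      t≡1 with m^n≡1⇒n≡0∨m≡1 t (suc m) t^m≡1
      ... | inj₂ t≡1 = t≡1
      x≡y : x ≡ y
      x≡y = trans x≡t*y (trans (cong (_* y) t≡1) (*-identityˡ y))
    ordered {x} {y} m _ m≤n n≤s eq | suc d , refl
      with ^≡^*^⇒quotient m (suc d) (trans eq (^-distribˡ-+-* y (suc m) (suc d)))
    ... | t , x≡t*y , t^m≡y^d =
      commonBase-*ˡ x≡t*y (ih (<-≤-trans (+-monoʳ-< m (n<1+n d)) n≤s) m d refl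
                                {{m*n≢0⇒m≢0 t {{subst NonZero x≡t*y it}}}} t^m≡y^d)

-- Multiplicative dependence as an identity in ℕ

infix 10 _⁺ _⁻

_⁺ _⁻ : ℤ → ℕ
(+ m) ⁺    = m
-[1+ m ] ⁺ = 0
(+ m) ⁻    = 0
-[1+ m ] ⁻ = suc m

⁺≡⁻⇒≡0 : ∀ k → k ⁺ ≡ k ⁻ → k ≡ + 0
⁺≡⁻⇒≡0 (+ zero) _ = refl

ι : ℕ → ℚ
ι n = + n / 1

ι≡mkℚ : ∀ n → ι n ≡ mkℚ (+ n) 0 (C.sym (C.1-coprimeTo n))
ι≡mkℚ n = ℚ.normalize-coprime (C.sym (C.1-coprimeTo n))

ι-* : ∀ m n → ι (m * n) ≡ ι m ℚ.* ι n
ι-* m n rewrite ι≡mkℚ m | ι≡mkℚ n = cong (_/ 1) (ℤ.pos-* m n)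

ι-injective : ∀ {m n} → ι m ≡ ι n → m ≡ n
ι-injective {m} {n} eq = cong ℤ.∣_∣ (cong ℚ.↥_ (trans (sym (ι≡mkℚ m)) (trans eq (ι≡mkℚ n))))

inv*ι≡1 : ∀ m → {{NonZero m}} → inv m ℚ.* ι m ≡ 1ℚ
inv*ι≡1 (suc m) rewrite ι≡mkℚ (suc m) | ℚ.normalize-coprime {1} {m} (C.1-coprimeTo (suc m)) =
  ℚ.*-inverseˡ (mkℚ (+ suc m) 0 (C.sym (C.1-coprimeTo (suc m))))

zpow*ι≡ι : ∀ m k → {{NonZero m}} → zpow m k ℚ.* ι (m ^ k ⁻) ≡ ι (m ^ k ⁺)
zpow*ι≡ι m (+ k)     = ℚ.*-identityʳ _
zpow*ι≡ι m -[1+ k ] = inv*ι≡1 (m ^ suc k) {{m^n≢0 m (suc k)}}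

-- z₁^k₁ ⋯ zₙ^kₙ = 1 with the negative powers moved to the right-hand side.
Balanced : ∀ {n} → (Fin n → ℕ) → (Fin n → ℤ) → Set
Balanced z k = z ^ᵛ (λ i → k i ⁺) ≡ z ^ᵛ (λ i → k i ⁻)

Dependent : ∀ {n} → (Fin n → ℕ) → Set
Dependent {n} z = Σ (Fin n → ℤ) λ k → (∃ λ i → k i ≢ + 0) × Balanced z k

∏ℚzpow*ι≡ι : ∀ {n} (z : Fin n → ℕ) (k : Fin n → ℤ) → (∀ i → NonZero (z i)) →
             ∏ℚ (λ i → zpow (z i) (k i)) ℚ.* ι (z ^ᵛ (λ i → k i ⁻))
             ≡ ι (z ^ᵛ (λ i → k i ⁺))
∏ℚzpow*ι≡ι {zero}  z k z≢0 = ℚ.*-identityˡ (ι 1)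
∏ℚzpow*ι≡ι {suc n} z k z≢0 = begin
  (Z₀ ℚ.* Zs) ℚ.* ι (z zero ^ k zero ⁻ * zs ^ᵛ (λ i → k (suc i) ⁻))
    ≡⟨ cong ((Z₀ ℚ.* Zs) ℚ.*_) (ι-* (z zero ^ k zero ⁻) _) ⟩
  (Z₀ ℚ.* Zs) ℚ.* (ι (z zero ^ k zero ⁻) ℚ.* ι (zs ^ᵛ (λ i → k (suc i) ⁻)))
    ≡⟨ ℚ-interchange Z₀ Zs _ _ ⟩
  (Z₀ ℚ.* ι (z zero ^ k zero ⁻)) ℚ.* (Zs ℚ.* ι (zs ^ᵛ (λ i → k (suc i) ⁻)))
    ≡⟨ cong₂ ℚ._*_ (zpow*ι≡ι (z zero) (k zero) {{z≢0 zero}})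
                   (∏ℚzpow*ι≡ι zs (k ∘ suc) (z≢0 ∘ suc)) ⟩
  ι (z zero ^ k zero ⁺) ℚ.* ι (zs ^ᵛ (λ i → k (suc i) ⁺))
    ≡⟨ ι-* (z zero ^ k zero ⁺) _ ⟨
  ι (z ^ᵛ (λ i → k i ⁺)) ∎
  where
  open ≡-Reasoning
  zs : Fin n → ℕ
  zs = z ∘ suc
  Z₀ Zs : ℚ
  Z₀ = zpow (z zero) (k zero)
  Zs = ∏ℚ (λ i → zpow (zs i) (k (suc i)))

multDep⇒dependent : ∀ {n} {z : Fin n → ℕ} → (∀ i → NonZero (z i)) → MultDep z → Dependent z
multDep⇒dependent {z = z} z≢0 (k , k≢0 , ∏≡1) = k , k≢0 , ι-injective (begin
  ι N⁺              ≡⟨ ∏ℚzpow*ι≡ι z k z≢0 ⟨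
  Z ℚ.* ι N⁻        ≡⟨ cong (ℚ._* ι N⁻) ∏≡1 ⟩
  1ℚ ℚ.* ι N⁻       ≡⟨ ℚ.*-identityˡ (ι N⁻) ⟩
  ι N⁻              ∎)
  where
  open ≡-Reasoning
  Z : ℚ
  Z = ∏ℚ (λ i → zpow (z i) (k i))
  N⁺ N⁻ : ℕ
  N⁺ = z ^ᵛ (λ i → k i ⁺)
  N⁻ = z ^ᵛ (λ i → k i ⁻)

dependent⇒multDep : ∀ {n} {z : Fin n → ℕ} → (∀ i → NonZero (z i)) → Dependent z → MultDep z
dependent⇒multDep {z = z} z≢0 (k , k≢0 , bal) = k , k≢0 , (begin
  Z                          ≡⟨ ℚ.*-identityʳ Z ⟨
  Z ℚ.* 1ℚ                   ≡⟨ cong (Z ℚ.*_) (inv*ι≡1 N⁻) ⟨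
  Z ℚ.* (inv N⁻ ℚ.* ι N⁻)    ≡⟨ ℚ-x∙yz≈y∙xz Z (inv N⁻) (ι N⁻) ⟩
  inv N⁻ ℚ.* (Z ℚ.* ι N⁻)    ≡⟨ cong (inv N⁻ ℚ.*_) (trans (∏ℚzpow*ι≡ι z k z≢0) (cong ι bal)) ⟩
  inv N⁻ ℚ.* ι N⁻            ≡⟨ inv*ι≡1 N⁻ ⟩
  1ℚ                         ∎)
  where
  open ≡-Reasoning
  Z : ℚ
  Z = ∏ℚ (λ i → zpow (z i) (k i))
  N⁻ : ℕ
  N⁻ = z ^ᵛ (λ i → k i ⁻)
  instance
    N⁻≢0 : NonZero N⁻
    N⁻≢0 = ^ᵛ-nonZero z (λ i → k i ⁻) z≢0

dependent-cong : ∀ {n} {z w : Fin n → ℕ} → (∀ i → z i ≡ w i) → Dependent z → Dependent w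
dependent-cong z≡w (k , k≢0 , bal) = k , k≢0 ,
  trans (^ᵛ-cong {e = λ i → k i ⁺} (sym ∘ z≡w) (λ _ → refl))
        (trans bal (^ᵛ-cong {e = λ i → k i ⁻} z≡w (λ _ → refl)))

dependent-punchIn : ∀ {n} {z : Fin (suc n) → ℕ} (k : Fin (suc n) → ℤ) → (∃ λ j → k j ≢ + 0) →
                    Balanced z k → ∀ i → k i ≡ + 0 → Dependent (λ j → z (punchIn i j))
dependent-punchIn {z = z} k (j , kj≢0) bal i ki≡0 =
  (λ j → k (punchIn i j)) ,
  (punchOut i≢j , λ eq → kj≢0 (trans (cong k (sym (FinP.punchIn-punchOut i≢j))) eq)) ,
  trans (sym (unpunch _⁺ refl)) (trans bal (unpunch _⁻ refl))
  where
  R : (ℤ → ℕ) → ℕ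
  R s = (λ j → z (punchIn i j)) ^ᵛ (λ j → s (k (punchIn i j)))
  unpunch : ∀ s → s (+ 0) ≡ 0 → z ^ᵛ (λ l → s (k l)) ≡ R s
  unpunch s s0≡0 = trans (^ᵛ-punchIn z (s ∘ k) i)
    (trans (cong (λ e → z i ^ e * R s) (trans (cong s ki≡0) s0≡0)) (*-identityˡ (R s)))
  i≢j : i ≢ j
  i≢j i≡j = kj≢0 (trans (cong k (sym i≡j)) ki≡0)

pair^ᵛ : ∀ u v (e : Fin 2 → ℕ) → pair u v ^ᵛ e ≡ u ^ e zero * v ^ e (suc zero)
pair^ᵛ u v e = cong (u ^ e zero *_) (*-identityʳ _)

pair-balanced : ∀ {u v} (k : Fin 2 → ℤ) →
                u ^ k zero ⁺ * v ^ k (suc zero) ⁺ ≡ u ^ k zero ⁻ * v ^ k (suc zero) ⁻ →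
                Balanced (pair u v) k
pair-balanced {u} {v} k eq =
  trans (pair^ᵛ u v (λ j → k j ⁺)) (trans eq (sym (pair^ᵛ u v (λ j → k j ⁻))))

^≡^⇒dependent : ∀ {u v} g h → 1 ≤ g → 1 ≤ h → u ^ g ≡ v ^ h → Dependent (pair u v)
^≡^⇒dependent {u} {v} (suc g) (suc h) _ _ eq =
  k , (zero , λ ()) , pair-balanced {u} {v} k (trans (*-identityʳ _) (trans eq (sym (*-identityˡ _))))
  where
  k : Fin 2 → ℤ
  k zero    = + suc g
  k (suc _) = -[1+ h ]

balanced⇒commonBase : ∀ {B C} → {{NonZero B}} → {{NonZero C}} → (k : Fin 2 → ℤ) →
                      k zero ≢ + 0 → k (suc zero) ≢ + 0 → Balanced (pair B C) k → CommonBase B C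
balanced⇒commonBase {B} {C} k k₀≢0 k₁≢0 bal =
  signs (k zero) (k (suc zero)) k₀≢0 k₁≢0
    (trans (sym (pair^ᵛ B C (λ j → k j ⁺))) (trans bal (pair^ᵛ B C (λ j → k j ⁻))))
  where
  units : ∀ m n → B ^ suc m * C ^ suc n ≡ 1 → CommonBase B C
  units m n eq = subst₂ CommonBase (sym B≡1) (sym C≡1) (commonBase-refl 1)
    where
    B≡1 : B ≡ 1
    B≡1 = m*n≡1⇒m≡1 B _ (m*n≡1⇒m≡1 (B ^ suc m) _ eq)
    C≡1 : C ≡ 1
    C≡1 = m*n≡1⇒m≡1 C _ (m*n≡1⇒n≡1 (B ^ suc m) _ eq)
  opposite : ∀ m n → B ^ suc m * 1 ≡ 1 * C ^ suc n → CommonBase B C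
  opposite m n eq = ^≡^⇒commonBase m n (trans (sym (*-identityʳ _)) (trans eq (*-identityˡ _)))
  signs : ∀ k l → k ≢ + 0 → l ≢ + 0 → B ^ k ⁺ * C ^ l ⁺ ≡ B ^ k ⁻ * C ^ l ⁻ → CommonBase B C
  signs (+ zero)  _         k≢0 _   _  = contradiction refl k≢0
  signs _         (+ zero)  _   l≢0 _  = contradiction refl l≢0
  signs (+ suc m) (+ suc n) _   _   eq = units m n eq
  signs -[1+ m ]  -[1+ n ]  _   _   eq = units m n (sym eq)
  signs (+ suc m) -[1+ n ]  _   _   eq = opposite m n eq
  signs -[1+ m ]  (+ suc n) _   _   eq = opposite m n (sym eq)

commonBase-pair^ᵛ : ∀ {B C} (cb : CommonBase B C) (e : Fin 2 → ℕ) →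
                    let open CommonBase cb in pair B C ^ᵛ e ≡ q ^ (β * e zero + γ * e (suc zero))
commonBase-pair^ᵛ {B} {C} cb e = begin
  pair B C ^ᵛ e                              ≡⟨ pair^ᵛ B C e ⟩
  B ^ e zero * C ^ e (suc zero)              ≡⟨ cong₂ (λ u v → u ^ e zero * v ^ e (suc zero)) x≡q^β y≡q^γ ⟩
  (q ^ β) ^ e zero * (q ^ γ) ^ e (suc zero)  ≡⟨ cong₂ _*_ (^-*-assoc q β _) (^-*-assoc q γ _) ⟩
  q ^ (β * e zero) * q ^ (γ * e (suc zero))  ≡⟨ ^-distribˡ-+-* q (β * e zero) (γ * e (suc zero)) ⟨
  q ^ (β * e zero + γ * e (suc zero))        ∎
  where
  open ≡-Reasoning
  open CommonBase cb

commonBase-balanced : ∀ {B C} (cb : CommonBase B C) (k : Fin 2 → ℤ) → let open CommonBase cb in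
                      Balanced (pair B C) k → 1 < q →
                      β * k zero ⁺ + γ * k (suc zero) ⁺ ≡ β * k zero ⁻ + γ * k (suc zero) ⁻
commonBase-balanced cb k bal 1<q = ^-cancelˡ-≡ 1<q
  (trans (sym (commonBase-pair^ᵛ cb (λ j → k j ⁺))) (trans bal (commonBase-pair^ᵛ cb (λ j → k j ⁻))))

^ᵛ*-^ : ∀ {n} (p y : Fin n → ℕ) B e → (p ^ᵛ y * B) ^ e ≡ p ^ᵛ (λ i → y i * e) * B ^ e
^ᵛ*-^ p y B e = trans (^-distribʳ-* (p ^ᵛ y) B e) (cong (_* B ^ e) (^ᵛ-^ p y e))

triple^ᵛ : ∀ {n} (p x y z : Fin n → ℕ) {a b c B C} →
           a ≡ p ^ᵛ x → b ≡ p ^ᵛ y * B → c ≡ p ^ᵛ z * C → ∀ e →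
           triple a b c ^ᵛ e ≡ p ^ᵛ (λ i → x i * e zero + (y i * e (suc zero) + z i * e (suc (suc zero))))
                                * pair B C ^ᵛ (e ∘ suc)
triple^ᵛ {n} p x y z {B = B} {C} refl refl refl e = begin
  (p ^ᵛ x) ^ e₀ * ((p ^ᵛ y * B) ^ e₁ * ((p ^ᵛ z * C) ^ e₂ * 1))
    ≡⟨ cong₂ _*_ (^ᵛ-^ p x e₀) (cong₂ _*_ (^ᵛ*-^ p y B e₁) (cong (_* 1) (^ᵛ*-^ p z C e₂))) ⟩
  P x e₀ * ((P y e₁ * B ^ e₁) * ((P z e₂ * C ^ e₂) * 1))
    ≡⟨ rearrange (P x e₀) (P y e₁) (P z e₂) (B ^ e₁) (C ^ e₂) ⟩
  (P x e₀ * (P y e₁ * P z e₂)) * (B ^ e₁ * (C ^ e₂ * 1))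
    ≡⟨ cong (_* (B ^ e₁ * (C ^ e₂ * 1)))
            (trans (^ᵛ-distribˡ-+-* p (λ i → x i * e₀) (λ i → y i * e₁ + z i * e₂))
                   (cong (P x e₀ *_) (^ᵛ-distribˡ-+-* p (λ i → y i * e₁) (λ i → z i * e₂)))) ⟨
  p ^ᵛ (λ i → x i * e₀ + (y i * e₁ + z i * e₂)) * (B ^ e₁ * (C ^ e₂ * 1)) ∎
  where
  open ≡-Reasoning
  e₀ e₁ e₂ : ℕ
  e₀ = e zero
  e₁ = e (suc zero)
  e₂ = e (suc (suc zero))
  P : (Fin n → ℕ) → ℕ → ℕ
  P w k = p ^ᵛ (λ i → w i * k)
  rearrange : ∀ X Y Z U V → X * ((Y * U) * ((Z * V) * 1)) ≡ (X * (Y * Z)) * (U * (V * 1))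
  rearrange = solve-∀

proportional⇒^≡^ : ∀ {n} (p y z : Fin n → ℕ) q β γ → (∀ i → γ * y i ≡ β * z i) →
                   (p ^ᵛ y * q ^ β) ^ γ ≡ (p ^ᵛ z * q ^ γ) ^ β
proportional⇒^≡^ p y z q β γ γy≡βz = begin
  (p ^ᵛ y * q ^ β) ^ γ                  ≡⟨ ^ᵛ*-^ p y (q ^ β) γ ⟩
  p ^ᵛ (λ i → y i * γ) * (q ^ β) ^ γ    ≡⟨ cong₂ _*_ (^ᵛ-cong (λ _ → refl) y*γ≡z*β) q^β^γ≡q^γ^β ⟩
  p ^ᵛ (λ i → z i * β) * (q ^ γ) ^ β    ≡⟨ ^ᵛ*-^ p z (q ^ γ) β ⟨
  (p ^ᵛ z * q ^ γ) ^ β                  ∎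
  where
  open ≡-Reasoning
  y*γ≡z*β : ∀ i → y i * γ ≡ z i * β
  y*γ≡z*β i = trans (*-comm (y i) γ) (trans (γy≡βz i) (*-comm β (z i)))
  q^β^γ≡q^γ^β : (q ^ β) ^ γ ≡ (q ^ γ) ^ β
  q^β^γ≡q^γ^β = trans (^-*-assoc q β γ) (trans (cong (q ^_) (*-comm β γ)) (sym (^-*-assoc q γ β)))

proportional-cancel : ∀ x y z β γ {a⁺ a⁻ b⁺ b⁻ c⁺ c⁻} → {{NonZero β}} → {{NonZero x}} →
                      β * z ≡ γ * y →
                      x * a⁺ + (y * b⁺ + z * c⁺) ≡ x * a⁻ + (y * b⁻ + z * c⁻) →
                      β * b⁺ + γ * c⁺ ≡ β * b⁻ + γ * c⁻ → a⁺ ≡ a⁻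
proportional-cancel x y z β γ {a⁺} {a⁻} {b⁺} {b⁻} {c⁺} {c⁻} βz≡γy rel bal =
  *-cancelˡ-≡ a⁺ a⁻ (β * x) {{m*n≢0 β x}} (+-cancelʳ-≡ _ (β * x * a⁺) (β * x * a⁻) (begin
    β * x * a⁺ + y * (β * b⁺ + γ * c⁺)   ≡⟨ regroup a⁺ b⁺ c⁺ ⟨
    β * (x * a⁺ + (y * b⁺ + z * c⁺))     ≡⟨ cong (β *_) rel ⟩
    β * (x * a⁻ + (y * b⁻ + z * c⁻))     ≡⟨ regroup a⁻ b⁻ c⁻ ⟩
    β * x * a⁻ + y * (β * b⁻ + γ * c⁻)   ≡⟨ cong (λ t → β * x * a⁻ + y * t) bal ⟨
    β * x * a⁻ + y * (β * b⁺ + γ * c⁺)   ∎))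
  where
  open ≡-Reasoning
  regroup : ∀ a b c → β * (x * a + (y * b + z * c)) ≡ β * x * a + y * (β * b + γ * c)
  regroup a b c = begin
    β * (x * a + (y * b + z * c))             ≡⟨ expand β x y z a b c ⟩
    β * x * a + (y * (β * b) + (β * z) * c)   ≡⟨ cong (λ t → β * x * a + (y * (β * b) + t * c)) βz≡γy ⟩
    β * x * a + (y * (β * b) + (γ * y) * c)   ≡⟨ collect β γ x y a b c ⟩
    β * x * a + y * (β * b + γ * c)           ∎
    where
    expand : ∀ β x y z a b c →
             β * (x * a + (y * b + z * c)) ≡ β * x * a + (y * (β * b) + (β * z) * c)
    expand = solve-∀
    collect : ∀ β γ x y a b c →
              β * x * a + (y * (β * b) + (γ * y) * c) ≡ β * x * a + y * (β * b + γ * c)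
    collect = solve-∀

pair-nonZero : ∀ {u v} → 1 ≤ u → 1 ≤ v → ∀ j → NonZero (pair u v j)
pair-nonZero 1≤u _   zero    = >-nonZero 1≤u
pair-nonZero _   1≤v (suc _) = >-nonZero 1≤v

triple-nonZero : ∀ {u v w} → 1 ≤ u → 1 ≤ v → 1 ≤ w → ∀ i → NonZero (triple u v w i)
triple-nonZero 1≤u _   _   zero          = >-nonZero 1≤u
triple-nonZero _   1≤v _   (suc zero)    = >-nonZero 1≤v
triple-nonZero _   _   1≤w (suc (suc _)) = >-nonZero 1≤w

threeMultDep⇒balanced : ∀ {a b c} → 1 ≤ a → 1 ≤ b → 1 ≤ c → ThreeMultDep a b c →
                        ∃[ k ] (∀ i → k i ≢ + 0) × Balanced (triple a b c) k
threeMultDep⇒balanced {a} {b} {c} 1≤a 1≤b 1≤c (dep , ¬ab , ¬ac , ¬bc) = k , k≢0 , bal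
  where
  dependent : Dependent (triple a b c)
  dependent = multDep⇒dependent (triple-nonZero 1≤a 1≤b 1≤c) dep
  k : Fin 3 → ℤ
  k = proj₁ dependent
  nontrivial : ∃ λ i → k i ≢ + 0
  nontrivial = proj₁ (proj₂ dependent)
  bal : Balanced (triple a b c) k
  bal = proj₂ (proj₂ dependent)
  dropped : ∀ i {u v} → 1 ≤ u → 1 ≤ v → (∀ j → triple a b c (punchIn i j) ≡ pair u v j) →
            ¬ MultDep (pair u v) → k i ≢ + 0
  dropped i 1≤u 1≤v abc≡uv ¬uv ki≡0 = ¬uv (dependent⇒multDep (pair-nonZero 1≤u 1≤v)
    (dependent-cong abc≡uv (dependent-punchIn {z = triple a b c} k nontrivial bal i ki≡0)))
  k≢0 : ∀ i → k i ≢ + 0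
  k≢0 zero             = dropped zero 1≤b 1≤c (λ { zero → refl ; (suc zero) → refl }) ¬bc
  k≢0 (suc zero)       = dropped (suc zero) 1≤a 1≤c (λ { zero → refl ; (suc zero) → refl }) ¬ac
  k≢0 (suc (suc zero)) = dropped (suc (suc zero)) 1≤a 1≤b (λ { zero → refl ; (suc zero) → refl }) ¬ab

-- xᵢk₀ + yᵢk₁ + zᵢk₂ = 0 for every i, with the negative terms moved to the right-hand side.
BalancedExponents : ∀ {n} (x y z : Fin n → ℕ) → (Fin 3 → ℤ) → Set
BalancedExponents x y z k =
  ∀ i → x i * k zero ⁺ + (y i * k (suc zero) ⁺ + z i * k (suc (suc zero)) ⁺)
      ≡ x i * k zero ⁻ + (y i * k (suc zero) ⁻ + z i * k (suc (suc zero)) ⁻)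

triple-balanced-split :
  ∀ {n} (p x y z : Fin n → ℕ) {a b c B C} (k : Fin 3 → ℤ) →
  (∀ i → Prime (p i)) → Injective _≡_ _≡_ p → (∀ i → p i ∤ B) → (∀ i → p i ∤ C) →
  a ≡ p ^ᵛ x → b ≡ p ^ᵛ y * B → c ≡ p ^ᵛ z * C → Balanced (triple a b c) k →
  BalancedExponents x y z k × Balanced (pair B C) (k ∘ suc)
triple-balanced-split p x y z {B = B} {C} k p-prime p-inj p∤B p∤C a≡ b≡ c≡ bal =
  ^ᵛ*-injective p p-prime p-inj _ _ (p∤BC (λ j → k (suc j) ⁺)) (p∤BC (λ j → k (suc j) ⁻))
    (trans (sym (triple^ᵛ p x y z a≡ b≡ c≡ (λ j → k j ⁺)))
           (trans bal (triple^ᵛ p x y z a≡ b≡ c≡ (λ j → k j ⁻))))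
  where
  p∤BC : ∀ e i → p i ∤ pair B C ^ᵛ e
  p∤BC e i = prime∤^ᵛ (pair B C) e (p-prime i) λ { zero → p∤B i ; (suc _) → p∤C i }

lemma4p1 : (a b c : ℕ) → 1 ≤ a → 1 ≤ b → 1 ≤ c → ThreeMultDep a b c →
  (n : ℕ) (p x : Fin n → ℕ) → (∀ i → Prime (p i)) → Injective _≡_ _≡_ p →
  (∀ i → 1 ≤ x i) → a ≡ ∏ (λ i → p i ^ x i) →
  Σ (Fin n → ℕ) λ y → Σ (Fin n → ℕ) λ z → Σ ℕ λ q → Σ ℕ λ β → Σ ℕ λ γ →
    1 ≤ q × 1 ≤ β × 1 ≤ γ ×
    b ≡ ∏ (λ i → p i ^ y i) * q ^ β ×
    c ≡ ∏ (λ i → p i ^ z i) * q ^ γ ×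
    ¬ (∀ i → γ * y i ≡ β * z i) ×
    (1 < q → ∀ i → γ * y i ≢ β * z i)
lemma4p1 a b c 1≤a 1≤b 1≤c dep@(_ , _ , _ , ¬bc) n p x p-prime p-inj 1≤x a≡
  with decompose p p-prime b {{>-nonZero 1≤b}} | decompose p p-prime c {{>-nonZero 1≤c}}
... | y , B , b≡ , p∤B | z , C , c≡ , p∤C =
  y , z , q , β , γ , 1≤q , 1≤β , 1≤γ , b≡pʸqᵝ , c≡pᶻqᵞ , not-proportional , nowhere-proportional
  where
  balanced : ∃[ k ] (∀ i → k i ≢ + 0) × Balanced (triple a b c) k
  balanced = threeMultDep⇒balanced 1≤a 1≤b 1≤c dep
  k : Fin 3 → ℤ
  k = proj₁ balanced
  k≢0 : ∀ i → k i ≢ + 0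
  k≢0 = proj₁ (proj₂ balanced)
  split : BalancedExponents x y z k × Balanced (pair B C) (k ∘ suc)
  split = triple-balanced-split p x y z k p-prime p-inj p∤B p∤C a≡ b≡ c≡ (proj₂ (proj₂ balanced))
  relation : BalancedExponents x y z k
  relation = proj₁ split
  cofactors : Balanced (pair B C) (k ∘ suc)
  cofactors = proj₂ split

  instance
    B≢0 : NonZero B
    B≢0 = m*n≢0⇒n≢0 (p ^ᵛ y) {{subst NonZero b≡ (>-nonZero 1≤b)}}
    C≢0 : NonZero C
    C≢0 = m*n≢0⇒n≢0 (p ^ᵛ z) {{subst NonZero c≡ (>-nonZero 1≤c)}}

  cb : CommonBase B C
  cb = balanced⇒commonBase (k ∘ suc) (k≢0 (suc zero)) (k≢0 (suc (suc zero))) cofactors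
  open CommonBase cb

  b≡pʸqᵝ : b ≡ p ^ᵛ y * q ^ β
  b≡pʸqᵝ = subst (λ t → b ≡ p ^ᵛ y * t) x≡q^β b≡
  c≡pᶻqᵞ : c ≡ p ^ᵛ z * q ^ γ
  c≡pᶻqᵞ = subst (λ t → c ≡ p ^ᵛ z * t) y≡q^γ c≡

  not-proportional : ¬ (∀ i → γ * y i ≡ β * z i)
  not-proportional γy≡βz = ¬bc (dependent⇒multDep (pair-nonZero 1≤b 1≤c)
    (^≡^⇒dependent γ β 1≤γ 1≤β (subst₂ (λ u v → u ^ γ ≡ v ^ β) (sym b≡pʸqᵝ) (sym c≡pᶻqᵞ)
                                       (proportional⇒^≡^ p y z q β γ γy≡βz))))

  nowhere-proportional : 1 < q → ∀ i → γ * y i ≢ β * z i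
  nowhere-proportional 1<q i γyᵢ≡βzᵢ = k≢0 zero (⁺≡⁻⇒≡0 (k zero)
    (proportional-cancel (x i) (y i) (z i) β γ {{>-nonZero 1≤β}} {{>-nonZero (1≤x i)}} (sym γyᵢ≡βzᵢ)
      (relation i) (commonBase-balanced cb (k ∘ suc) cofactors 1<q)))
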